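{- Let $\mathcal{C}$ be a restriction category and $T$ a symmetric monoidal monad on $\mathcal{C}$. Then $T$ is domain preserving if and only if the Kleisli category $\mathcal{C}_T$ is a domain category.
   Context: Composition is diagrammatic ($f;g$ means first $f$, then $g$); the right unitor is $\rho_X:X\to X\otimes I$. A gs-monoidal category is a symmetric monoidal category with, for each object $X$, a discharger $!_X:X\to I$ and duplicator $\nabla_X:X\to X\otimes X$, compatible with the monoidal structure, with $\nabla_X$ coassociative, cocommutative, and $(X,\nabla_X,!_X)$ a comonoid. A restriction category is a gs-monoidal category in which every arrow $f:X\to Y$ satisfies $f;\nabla_Y=\nabla_X;(f\otimes f)$. A symmetric monoidal monad $(T,\eta,\mu)$ is a monad whose functor is lax symmetric monoidal with structure $c_{X,Y}:TX\otimes TY\to T(X\otimes Y)$ and unit structure $\eta_I$, such that $\eta$ and $\mu$ are monoidal natural transformations. Its Kleisli category $\mathcal{C}_T$ has the objects of $\mathcal{C}$, arrows $X\to Y$ the arrows $X\to TY$ of $\mathcal{C}$, composition $f;^\sharp g=f;T(g);\mu$, and is gs-monoidal with tensor $f\otimes^\sharp g=(f\otimes g);c$ and structural arrows $\nabla_X;\eta_{X\otimes X}$ and $!_X;\eta_I$. For an arrow $f:X\to Y$ of a gs-monoidal category, $\mathrm{dom}(f):=\nabla_X;(\mathrm{id}_X\otimes(f;!_Y));\rho^{ -1}_X$; a domain category is a gs-monoidal category with $\mathrm{dom}(f);f=f$ for all $f$. $T$ is domain preserving if for all $X$: $\nabla_{TX};c_{X,X};T(\mathrm{id}_X\otimes !_X)=T(\rho_X)$.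 -}

module Defs where

open import Level using (Level; _⊔_) renaming (suc to lsuc)
open import Relation.Binary.PropositionalEquality using (_≡_)

-- Conventions: composition is diagrammatic (f ⨾ g = "first f, then g");
-- equality of arrows is propositional equality on the hom-types.
-- α X Y Z : (X ⊗ Y) ⊗ Z → X ⊗ (Y ⊗ Z);  ρ X : X → X ⊗ I;  lunit X : X → I ⊗ X.

record SymmetricMonoidalCategory (o ℓ : Level) : Set (lsuc (o ⊔ ℓ)) where
  infixl 5 _⨾_
  infixr 10 _⊗₀_ _⊗₁_
  field
    Obj : Set o
    Hom : Obj → Obj → Set ℓ
    id  : ∀ {A} → Hom A A
    _⨾_ : ∀ {A B C} → Hom A B → Hom B C → Hom A C
    identityˡ : ∀ {A B} {f : Hom A B} → id ⨾ f ≡ f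
    identityʳ : ∀ {A B} {f : Hom A B} → f ⨾ id ≡ f
    assoc : ∀ {A B C D} {f : Hom A B} {g : Hom B C} {h : Hom C D} →
            (f ⨾ g) ⨾ h ≡ f ⨾ (g ⨾ h)

    _⊗₀_ : Obj → Obj → Obj
    I    : Obj
    _⊗₁_ : ∀ {A B C D} → Hom A B → Hom C D → Hom (A ⊗₀ C) (B ⊗₀ D)
    ⊗-id : ∀ {A B} → id {A} ⊗₁ id {B} ≡ id
    ⊗-⨾  : ∀ {A B C D E F} {f : Hom A B} {g : Hom B C} {h : Hom D E} {k : Hom E F} →
           (f ⨾ g) ⊗₁ (h ⨾ k) ≡ (f ⊗₁ h) ⨾ (g ⊗₁ k)

    α    : ∀ X Y Z → Hom ((X ⊗₀ Y) ⊗₀ Z) (X ⊗₀ (Y ⊗₀ Z))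
    α⁻¹  : ∀ X Y Z → Hom (X ⊗₀ (Y ⊗₀ Z)) ((X ⊗₀ Y) ⊗₀ Z)
    α-iso₁ : ∀ {X Y Z} → α X Y Z ⨾ α⁻¹ X Y Z ≡ id
    α-iso₂ : ∀ {X Y Z} → α⁻¹ X Y Z ⨾ α X Y Z ≡ id
    α-nat : ∀ {A B C D E F} {f : Hom A B} {g : Hom C D} {h : Hom E F} →
            ((f ⊗₁ g) ⊗₁ h) ⨾ α B D F ≡ α A C E ⨾ (f ⊗₁ (g ⊗₁ h))

    ρ    : ∀ X → Hom X (X ⊗₀ I)
    ρ⁻¹  : ∀ X → Hom (X ⊗₀ I) X
    ρ-iso₁ : ∀ {X} → ρ X ⨾ ρ⁻¹ X ≡ id
    ρ-iso₂ : ∀ {X} → ρ⁻¹ X ⨾ ρ X ≡ id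
    ρ-nat : ∀ {A B} {f : Hom A B} → f ⨾ ρ B ≡ ρ A ⨾ (f ⊗₁ id)

    lunit    : ∀ X → Hom X (I ⊗₀ X)
    lunit⁻¹  : ∀ X → Hom (I ⊗₀ X) X
    lunit-iso₁ : ∀ {X} → lunit X ⨾ lunit⁻¹ X ≡ id
    lunit-iso₂ : ∀ {X} → lunit⁻¹ X ⨾ lunit X ≡ id
    lunit-nat : ∀ {A B} {f : Hom A B} → f ⨾ lunit B ≡ lunit A ⨾ (id ⊗₁ f)

    pentagon : ∀ {W X Y Z} →
      (α W X Y ⊗₁ id {Z}) ⨾ α W (X ⊗₀ Y) Z ⨾ (id {W} ⊗₁ α X Y Z)
        ≡ α (W ⊗₀ X) Y Z ⨾ α W X (Y ⊗₀ Z)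
    triangle : ∀ {X Y} → (ρ X ⊗₁ id {Y}) ⨾ α X I Y ≡ id {X} ⊗₁ lunit Y

    σ : ∀ X Y → Hom (X ⊗₀ Y) (Y ⊗₀ X)
    σ-nat : ∀ {A B C D} {f : Hom A B} {g : Hom C D} →
            (f ⊗₁ g) ⨾ σ B D ≡ σ A C ⨾ (g ⊗₁ f)
    σ-invol : ∀ {X Y} → σ X Y ⨾ σ Y X ≡ id
    hexagon : ∀ {X Y Z} →
      α X Y Z ⨾ σ X (Y ⊗₀ Z) ⨾ α Y Z X ≡ (σ X Y ⊗₁ id {Z}) ⨾ α Y X Z ⨾ (id {Y} ⊗₁ σ X Z)

module _ {o ℓ} (C : SymmetricMonoidalCategory o ℓ) where
  open SymmetricMonoidalCategory C

  middleSwap : ∀ X Y → Hom ((X ⊗₀ X) ⊗₀ (Y ⊗₀ Y)) ((X ⊗₀ Y) ⊗₀ (X ⊗₀ Y))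
  middleSwap X Y =
    α X X (Y ⊗₀ Y) ⨾ (id ⊗₁ α⁻¹ X Y Y) ⨾ (id ⊗₁ (σ X Y ⊗₁ id)) ⨾ (id ⊗₁ α Y X Y)
      ⨾ α⁻¹ X Y (X ⊗₀ Y)

record GSMonoidal {o ℓ} (C : SymmetricMonoidalCategory o ℓ) : Set (o ⊔ ℓ) where
  open SymmetricMonoidalCategory C
  field
    ! : ∀ X → Hom X I
    ∇ : ∀ X → Hom X (X ⊗₀ X)
    ∇-coassoc : ∀ {X} → ∇ X ⨾ (id ⊗₁ ∇ X) ≡ ∇ X ⨾ (∇ X ⊗₁ id) ⨾ α X X X
    ∇-cocomm  : ∀ {X} → ∇ X ⨾ σ X X ≡ ∇ X
    counitʳ   : ∀ {X} → ∇ X ⨾ (id ⊗₁ ! X) ⨾ ρ⁻¹ X ≡ id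
    counitˡ   : ∀ {X} → ∇ X ⨾ (! X ⊗₁ id) ⨾ lunit⁻¹ X ≡ id
    !-I  : ! I ≡ id
    ∇-I  : ∇ I ≡ ρ I
    !-⊗  : ∀ {X Y} → ! (X ⊗₀ Y) ≡ (! X ⊗₁ ! Y) ⨾ ρ⁻¹ I
    ∇-⊗  : ∀ {X Y} → ∇ (X ⊗₀ Y) ≡ (∇ X ⊗₁ ∇ Y) ⨾ middleSwap C X Y

IsRestriction : ∀ {o ℓ} {C : SymmetricMonoidalCategory o ℓ} → GSMonoidal C → Set (o ⊔ ℓ)
IsRestriction {C = C} G =
  ∀ {X Y} (f : Hom X Y) → f ⨾ ∇ Y ≡ ∇ X ⨾ (f ⊗₁ f)
  where open SymmetricMonoidalCategory C
        open GSMonoidal G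

record SymmetricMonoidalMonad {o ℓ} (C : SymmetricMonoidalCategory o ℓ) : Set (o ⊔ ℓ) where
  open SymmetricMonoidalCategory C
  field
    T₀ : Obj → Obj
    T₁ : ∀ {A B} → Hom A B → Hom (T₀ A) (T₀ B)
    T-id : ∀ {A} → T₁ (id {A}) ≡ id
    T-⨾  : ∀ {A B C} {f : Hom A B} {g : Hom B C} → T₁ (f ⨾ g) ≡ T₁ f ⨾ T₁ g

    η : ∀ X → Hom X (T₀ X)
    μ : ∀ X → Hom (T₀ (T₀ X)) (T₀ X)
    η-nat : ∀ {A B} {f : Hom A B} → f ⨾ η B ≡ η A ⨾ T₁ f
    μ-nat : ∀ {A B} {f : Hom A B} → T₁ (T₁ f) ⨾ μ B ≡ μ A ⨾ T₁ f
    unitˡ : ∀ {X} → η (T₀ X) ⨾ μ X ≡ id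
    unitʳ : ∀ {X} → T₁ (η X) ⨾ μ X ≡ id
    mult-assoc : ∀ {X} → T₁ (μ X) ⨾ μ X ≡ μ (T₀ X) ⨾ μ X

    c : ∀ X Y → Hom (T₀ X ⊗₀ T₀ Y) (T₀ (X ⊗₀ Y))
    c-nat : ∀ {A B C D} {f : Hom A B} {g : Hom C D} →
            (T₁ f ⊗₁ T₁ g) ⨾ c B D ≡ c A C ⨾ T₁ (f ⊗₁ g)
    c-assoc : ∀ {X Y Z} →
      (c X Y ⊗₁ id) ⨾ c (X ⊗₀ Y) Z ⨾ T₁ (α X Y Z)
        ≡ α (T₀ X) (T₀ Y) (T₀ Z) ⨾ (id ⊗₁ c Y Z) ⨾ c X (Y ⊗₀ Z)
    c-unitʳ : ∀ {X} → ρ (T₀ X) ⨾ (id ⊗₁ η I) ⨾ c X I ≡ T₁ (ρ X)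
    c-unitˡ : ∀ {X} → lunit (T₀ X) ⨾ (η I ⊗₁ id) ⨾ c I X ≡ T₁ (lunit X)
    c-sym : ∀ {X Y} → c X Y ⨾ T₁ (σ X Y) ≡ σ (T₀ X) (T₀ Y) ⨾ c Y X

    η-monoidal : ∀ {X Y} → (η X ⊗₁ η Y) ⨾ c X Y ≡ η (X ⊗₀ Y)
    μ-monoidal : ∀ {X Y} →
      (μ X ⊗₁ μ Y) ⨾ c X Y ≡ c (T₀ X) (T₀ Y) ⨾ T₁ (c X Y) ⨾ μ (X ⊗₀ Y)
    μ-monoidal-unit : η I ⨾ T₁ (η I) ⨾ μ I ≡ η I

DomainPreserving : ∀ {o ℓ} {C : SymmetricMonoidalCategory o ℓ} →
  GSMonoidal C → SymmetricMonoidalMonad C → Set (o ⊔ ℓ)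
DomainPreserving {C = C} G T =
  ∀ X → ∇ (T₀ X) ⨾ c X X ⨾ T₁ (id {X} ⊗₁ ! X) ≡ T₁ (ρ X)
  where open SymmetricMonoidalCategory C
        open GSMonoidal G
        open SymmetricMonoidalMonad T

record GSOps (o ℓ : Level) : Set (lsuc (o ⊔ ℓ)) where
  infixl 5 _⨾_
  infixr 10 _⊗₀_ _⊗₁_
  field
    Obj : Set o
    Hom : Obj → Obj → Set ℓ
    id  : ∀ {A} → Hom A A
    _⨾_ : ∀ {A B C} → Hom A B → Hom B C → Hom A C
    _⊗₀_ : Obj → Obj → Obj
    I    : Obj
    _⊗₁_ : ∀ {A B C D} → Hom A B → Hom C D → Hom (A ⊗₀ C) (B ⊗₀ D)
    ρ⁻¹  : ∀ X → Hom (X ⊗₀ I) X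
    ! : ∀ X → Hom X I
    ∇ : ∀ X → Hom X (X ⊗₀ X)

  dom : ∀ {X Y} → Hom X Y → Hom X X
  dom {X} {Y} f = ∇ X ⨾ (id ⊗₁ (f ⨾ ! Y)) ⨾ ρ⁻¹ X

IsDomainCategory : ∀ {o ℓ} → GSOps o ℓ → Set (o ⊔ ℓ)
IsDomainCategory D = ∀ {X Y} (f : Hom X Y) → dom f ⨾ f ≡ f
  where open GSOps D

ops : ∀ {o ℓ} {C : SymmetricMonoidalCategory o ℓ} → GSMonoidal C → GSOps o ℓ
ops {C = C} G = record
  { Obj = Obj ; Hom = Hom ; id = id ; _⨾_ = _⨾_ ; _⊗₀_ = _⊗₀_ ; I = I
  ; _⊗₁_ = _⊗₁_ ; ρ⁻¹ = ρ⁻¹ ; ! = ! ; ∇ = ∇ }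
  where open SymmetricMonoidalCategory C
        open GSMonoidal G

Kleisli : ∀ {o ℓ} {C : SymmetricMonoidalCategory o ℓ} →
  GSMonoidal C → SymmetricMonoidalMonad C → GSOps o ℓ
Kleisli {C = C} G T = record
  { Obj = Obj
  ; Hom = λ X Y → Hom X (T₀ Y)
  ; id = λ {A} → η A
  ; _⨾_ = λ {A} {B} {D} f g → f ⨾ T₁ g ⨾ μ D
  ; _⊗₀_ = _⊗₀_
  ; I = I
  ; _⊗₁_ = λ {A} {B} {D} {E} f g → (f ⊗₁ g) ⨾ c B E
  ; ρ⁻¹ = λ X → ρ⁻¹ X ⨾ η X
  ; ! = λ X → ! X ⨾ η I
  ; ∇ = λ X → ∇ X ⨾ η (X ⊗₀ X)
  }
  where open SymmetricMonoidalCategory C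
        open GSMonoidal G
        open SymmetricMonoidalMonad T

{-# OPTIONS --safe #-}
module Submission where

-- In the Kleisli category, dom f ⨾ f unfolds to f ⨾ copyDiscard Y, where
-- copyDiscard Y = ∇ ⨾ c ⨾ T(id ⊗ !) ⨾ T ρ⁻¹ : TY → TY. The computation goes through the
-- action act X = c ⨾ T ρ⁻¹ : TX ⊗ TI → TX, which commutes with μ because μ is monoidal,
-- and at the end uses that f is copyable in the restriction category 𝒞. Hence 𝒞_T is a
-- domain category iff every copyDiscard Y is the identity, and since T ρ is invertible
-- this is exactly domain preservation.

open import Defs
open import Function.Bundles using (Equivalence; _⇔_; mk⇔)
open import Function.Construct.Composition using (_⇔-∘_)
open import Function.Construct.Symmetry using (⇔-sym)
open import Relation.Binary.PropositionalEquality
open ≡-Reasoning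

module CategoryReasoning {o ℓ} (𝒞 : SymmetricMonoidalCategory o ℓ) where
  open SymmetricMonoidalCategory 𝒞

  private
    variable
      A B D E F : Obj

  pullʳ : {p : Hom A B} {a : Hom B D} {b : Hom D E} {r : Hom B E} →
          a ⨾ b ≡ r → p ⨾ a ⨾ b ≡ p ⨾ r
  pullʳ e = trans assoc (cong (_ ⨾_) e)

  pull³ʳ : {p : Hom A B} {a : Hom B D} {b : Hom D E} {d : Hom E F} {r : Hom B F} →
           a ⨾ b ⨾ d ≡ r → p ⨾ a ⨾ b ⨾ d ≡ p ⨾ r
  pull³ʳ e = trans (cong (_⨾ _) assoc) (pullʳ e)

  extendʳ : {p : Hom A B} {a : Hom B D} {b : Hom D F} {x : Hom B E} {y : Hom E F} →
            a ⨾ b ≡ x ⨾ y → p ⨾ a ⨾ b ≡ p ⨾ x ⨾ y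
  extendʳ e = trans (pullʳ e) (sym assoc)

  ⊗-⨾-first : {a : Hom A B} {b : Hom D E} {g : Hom B F} → (a ⊗₁ b) ⨾ (g ⊗₁ id) ≡ (a ⨾ g) ⊗₁ b
  ⊗-⨾-first = trans (sym ⊗-⨾) (cong (_ ⊗₁_) identityʳ)

  ⊗-⨾-second : {a : Hom A B} {b : Hom D E} {g : Hom E F} → (a ⊗₁ b) ⨾ (id ⊗₁ g) ≡ a ⊗₁ (b ⨾ g)
  ⊗-⨾-second = trans (sym ⊗-⨾) (cong (_⊗₁ _) identityʳ)

  cancelʳ : {p : Hom A B} {a : Hom B D} {b : Hom D B} → a ⨾ b ≡ id → p ⨾ a ⨾ b ≡ p
  cancelʳ e = trans (pullʳ e) identityʳ

  ≡⇔⨾inverse≡id : {g : Hom A B} {g⁻¹ : Hom B A} → g ⨾ g⁻¹ ≡ id → g⁻¹ ⨾ g ≡ id →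
                   (h : Hom A B) → (h ≡ g) ⇔ (h ⨾ g⁻¹ ≡ id)
  ≡⇔⨾inverse≡id {g = g} {g⁻¹} iso₁ iso₂ h = mk⇔ to from
    where
    to : h ≡ g → h ⨾ g⁻¹ ≡ id
    to refl = iso₁
    from : h ⨾ g⁻¹ ≡ id → h ≡ g
    from e = begin
      h              ≡⟨ sym (cancelʳ iso₂) ⟩
      h ⨾ g⁻¹ ⨾ g    ≡⟨ cong (_⨾ g) e ⟩
      id ⨾ g         ≡⟨ identityˡ ⟩
      g              ∎

  inverse-moveˡ : {a : Hom A B} {b : Hom B A} {f : Hom B D} {g : Hom A D} →
                  b ⨾ a ≡ id → a ⨾ f ≡ g → f ≡ b ⨾ g
  inverse-moveˡ {a = a} {b} {f} {g} iso e = begin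
    f              ≡⟨ sym identityˡ ⟩
    id ⨾ f         ≡⟨ cong (_⨾ f) (sym iso) ⟩
    b ⨾ a ⨾ f      ≡⟨ pullʳ e ⟩
    b ⨾ g          ∎

  ρ⁻¹-nat : {f : Hom A B} → ρ⁻¹ A ⨾ f ≡ (f ⊗₁ id) ⨾ ρ⁻¹ B
  ρ⁻¹-nat {A} {B} {f} = begin
    ρ⁻¹ A ⨾ f                          ≡⟨ sym (cancelʳ ρ-iso₁) ⟩
    ρ⁻¹ A ⨾ f ⨾ ρ B ⨾ ρ⁻¹ B            ≡⟨ cong (_⨾ ρ⁻¹ B) (extendʳ ρ-nat) ⟩
    ρ⁻¹ A ⨾ ρ A ⨾ (f ⊗₁ id) ⨾ ρ⁻¹ B    ≡⟨ cong (λ h → h ⨾ (f ⊗₁ id) ⨾ ρ⁻¹ B) ρ-iso₂ ⟩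
    id ⨾ (f ⊗₁ id) ⨾ ρ⁻¹ B             ≡⟨ cong (_⨾ ρ⁻¹ B) identityˡ ⟩
    (f ⊗₁ id) ⨾ ρ⁻¹ B                  ∎

module MonadLemmas {o ℓ} {𝒞 : SymmetricMonoidalCategory o ℓ} (𝕋 : SymmetricMonoidalMonad 𝒞) where
  open SymmetricMonoidalCategory 𝒞
  open SymmetricMonoidalMonad 𝕋
  open CategoryReasoning 𝒞

  private
    variable
      A B D : Obj

  T-iso : {f : Hom A B} {g : Hom B A} → f ⨾ g ≡ id → T₁ f ⨾ T₁ g ≡ id
  T-iso e = trans (sym T-⨾) (trans (cong T₁ e) T-id)

  ⨾ᴷ-pure : {k : Hom A (T₀ B)} {g : Hom B D} → k ⨾ T₁ (g ⨾ η D) ⨾ μ D ≡ k ⨾ T₁ g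
  ⨾ᴷ-pure = trans (cong (_⨾ μ _) (trans (cong (_ ⨾_) T-⨾) (sym assoc))) (cancelʳ unitʳ)

  Kleisli-identityˡ : {h : Hom A (T₀ B)} → η A ⨾ T₁ h ⨾ μ B ≡ h
  Kleisli-identityˡ =
    trans (cong (_⨾ μ _) (sym η-nat)) (trans assoc (trans (cong (_ ⨾_) unitˡ) identityʳ))

  act : ∀ X → Hom (T₀ X ⊗₀ T₀ I) (T₀ X)
  act X = c X I ⨾ T₁ (ρ⁻¹ X)

  act-nat : {f : Hom A B} → (T₁ f ⊗₁ id) ⨾ act B ≡ act A ⨾ T₁ f
  act-nat {A} {B} {f} = begin
    (T₁ f ⊗₁ id) ⨾ (c B I ⨾ T₁ (ρ⁻¹ B))     ≡⟨ sym assoc ⟩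
    (T₁ f ⊗₁ id) ⨾ c B I ⨾ T₁ (ρ⁻¹ B)       ≡⟨ cong (λ h → (T₁ f ⊗₁ h) ⨾ _ ⨾ _) (sym T-id) ⟩
    (T₁ f ⊗₁ T₁ id) ⨾ c B I ⨾ T₁ (ρ⁻¹ B)    ≡⟨ cong (_⨾ T₁ (ρ⁻¹ B)) c-nat ⟩
    c A I ⨾ T₁ (f ⊗₁ id) ⨾ T₁ (ρ⁻¹ B)       ≡⟨ pullʳ (sym T-⨾) ⟩
    c A I ⨾ T₁ ((f ⊗₁ id) ⨾ ρ⁻¹ B)          ≡⟨ cong (λ h → c A I ⨾ T₁ h) (sym ρ⁻¹-nat) ⟩
    c A I ⨾ T₁ (ρ⁻¹ A ⨾ f)                  ≡⟨ trans (cong (_ ⨾_) T-⨾) (sym assoc) ⟩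
    c A I ⨾ T₁ (ρ⁻¹ A) ⨾ T₁ f               ∎

  id⊗η⨾act≡ρ⁻¹ : ∀ {X} → (id ⊗₁ η I) ⨾ act X ≡ ρ⁻¹ (T₀ X)
  id⊗η⨾act≡ρ⁻¹ {X} = trans (inverse-moveˡ ρ-iso₂ ρ⨾id⊗η⨾act≡id) identityʳ
    where
    ρ⨾id⊗η⨾act≡id : ρ (T₀ X) ⨾ ((id ⊗₁ η I) ⨾ act X) ≡ id
    ρ⨾id⊗η⨾act≡id = begin
      ρ (T₀ X) ⨾ ((id ⊗₁ η I) ⨾ (c X I ⨾ T₁ (ρ⁻¹ X)))   ≡⟨ trans (sym assoc) (sym assoc) ⟩
      ρ (T₀ X) ⨾ (id ⊗₁ η I) ⨾ c X I ⨾ T₁ (ρ⁻¹ X)       ≡⟨ cong (_⨾ T₁ (ρ⁻¹ X)) c-unitʳ ⟩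
      T₁ (ρ X) ⨾ T₁ (ρ⁻¹ X)                             ≡⟨ T-iso ρ-iso₁ ⟩
      id                                                ∎

  act-μ : ∀ {X} → act (T₀ X) ⨾ μ X ≡ (μ X ⊗₁ id) ⨾ act X
  act-μ {X} = begin
    c (T₀ X) I ⨾ T₁ (ρ⁻¹ (T₀ X)) ⨾ μ X
      ≡⟨ cong (λ h → c (T₀ X) I ⨾ T₁ h ⨾ μ X) (sym id⊗η⨾act≡ρ⁻¹) ⟩
    c (T₀ X) I ⨾ T₁ ((id ⊗₁ η I) ⨾ act X) ⨾ μ X
      ≡⟨ cong (_⨾ μ X) (trans (cong (_ ⨾_) T-⨾) (sym assoc)) ⟩
    c (T₀ X) I ⨾ T₁ (id ⊗₁ η I) ⨾ T₁ (act X) ⨾ μ X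
      ≡⟨ cong (λ h → h ⨾ T₁ (act X) ⨾ μ X) (sym c-nat) ⟩
    (T₁ id ⊗₁ T₁ (η I)) ⨾ c (T₀ X) (T₀ I) ⨾ T₁ (act X) ⨾ μ X
      ≡⟨ cong₂ (λ h k → (h ⊗₁ T₁ (η I)) ⨾ c (T₀ X) (T₀ I) ⨾ k ⨾ μ X) T-id T-⨾ ⟩
    (id ⊗₁ T₁ (η I)) ⨾ c (T₀ X) (T₀ I) ⨾ (T₁ (c X I) ⨾ T₁ (T₁ (ρ⁻¹ X))) ⨾ μ X
      ≡⟨ cong (_⨾ μ X) (sym assoc) ⟩
    (id ⊗₁ T₁ (η I)) ⨾ c (T₀ X) (T₀ I) ⨾ T₁ (c X I) ⨾ T₁ (T₁ (ρ⁻¹ X)) ⨾ μ X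
      ≡⟨ extendʳ μ-nat ⟩
    (id ⊗₁ T₁ (η I)) ⨾ c (T₀ X) (T₀ I) ⨾ T₁ (c X I) ⨾ μ (X ⊗₀ I) ⨾ T₁ (ρ⁻¹ X)
      ≡⟨ cong (_⨾ T₁ (ρ⁻¹ X)) (trans (pull³ʳ (sym μ-monoidal)) (sym assoc)) ⟩
    (id ⊗₁ T₁ (η I)) ⨾ (μ X ⊗₁ μ I) ⨾ c X I ⨾ T₁ (ρ⁻¹ X)
      ≡⟨ cong (λ h → h ⨾ c X I ⨾ T₁ (ρ⁻¹ X)) (sym ⊗-⨾) ⟩
    ((id ⨾ μ X) ⊗₁ (T₁ (η I) ⨾ μ I)) ⨾ c X I ⨾ T₁ (ρ⁻¹ X)
      ≡⟨ cong₂ (λ h k → (h ⊗₁ k) ⨾ c X I ⨾ T₁ (ρ⁻¹ X)) identityˡ unitʳ ⟩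
    (μ X ⊗₁ id) ⨾ c X I ⨾ T₁ (ρ⁻¹ X)
      ≡⟨ assoc ⟩
    (μ X ⊗₁ id) ⨾ act X ∎

module KleisliDomain {o ℓ} {𝒞 : SymmetricMonoidalCategory o ℓ}
                     (G : GSMonoidal 𝒞) (𝕋 : SymmetricMonoidalMonad 𝒞) where
  open SymmetricMonoidalCategory 𝒞
  open GSMonoidal G
  open SymmetricMonoidalMonad 𝕋
  open CategoryReasoning 𝒞
  open MonadLemmas 𝕋
  private module K = GSOps (Kleisli G 𝕋)

  copyDiscard : ∀ Y → Hom (T₀ Y) (T₀ Y)
  copyDiscard Y = ∇ (T₀ Y) ⨾ c Y Y ⨾ T₁ (id ⊗₁ ! Y) ⨾ T₁ (ρ⁻¹ Y)

  copyDiscard≡act : ∀ {Y} → copyDiscard Y ≡ ∇ (T₀ Y) ⨾ (id ⊗₁ T₁ (! Y)) ⨾ act Y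
  copyDiscard≡act {Y} = begin
    ∇ (T₀ Y) ⨾ c Y Y ⨾ T₁ (id ⊗₁ ! Y) ⨾ T₁ (ρ⁻¹ Y)
      ≡⟨ cong (_⨾ T₁ (ρ⁻¹ Y)) (extendʳ (sym c-nat)) ⟩
    ∇ (T₀ Y) ⨾ (T₁ id ⊗₁ T₁ (! Y)) ⨾ c Y I ⨾ T₁ (ρ⁻¹ Y)
      ≡⟨ cong (λ h → ∇ (T₀ Y) ⨾ (h ⊗₁ T₁ (! Y)) ⨾ c Y I ⨾ T₁ (ρ⁻¹ Y)) T-id ⟩
    ∇ (T₀ Y) ⨾ (id ⊗₁ T₁ (! Y)) ⨾ c Y I ⨾ T₁ (ρ⁻¹ Y)
      ≡⟨ assoc ⟩
    ∇ (T₀ Y) ⨾ (id ⊗₁ T₁ (! Y)) ⨾ act Y ∎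

  Kleisli-dom : ∀ {X Y} (f : Hom X (T₀ Y)) → K.dom f ≡ ∇ X ⨾ (η X ⊗₁ (f ⨾ T₁ (! Y))) ⨾ act X
  Kleisli-dom {X} {Y} f = begin
    K.dom f
      ≡⟨ ⨾ᴷ-pure ⟩
    ∇ X ⨾ η (X ⊗₀ X) ⨾ T₁ ((η X ⊗₁ (f ⨾ T₁ (! Y ⨾ η I) ⨾ μ I)) ⨾ c X I) ⨾ μ (X ⊗₀ I) ⨾ T₁ (ρ⁻¹ X)
      ≡⟨ cong (_⨾ T₁ (ρ⁻¹ X)) (pull³ʳ Kleisli-identityˡ) ⟩
    ∇ X ⨾ ((η X ⊗₁ (f ⨾ T₁ (! Y ⨾ η I) ⨾ μ I)) ⨾ c X I) ⨾ T₁ (ρ⁻¹ X)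
      ≡⟨ cong (λ h → ∇ X ⨾ ((η X ⊗₁ h) ⨾ c X I) ⨾ T₁ (ρ⁻¹ X)) ⨾ᴷ-pure ⟩
    ∇ X ⨾ ((η X ⊗₁ (f ⨾ T₁ (! Y))) ⨾ c X I) ⨾ T₁ (ρ⁻¹ X)
      ≡⟨ trans (cong (_⨾ T₁ (ρ⁻¹ X)) (sym assoc)) assoc ⟩
    ∇ X ⨾ (η X ⊗₁ (f ⨾ T₁ (! Y))) ⨾ act X ∎

  Kleisli-dom-⨾ : IsRestriction G → ∀ {X Y} (f : Hom X (T₀ Y)) →
                  K.dom f K.⨾ f ≡ f ⨾ copyDiscard Y
  Kleisli-dom-⨾ copyable {X} {Y} f = begin
    K.dom f ⨾ T₁ f ⨾ μ Y
      ≡⟨ cong (λ h → h ⨾ T₁ f ⨾ μ Y) (Kleisli-dom f) ⟩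
    ∇ X ⨾ (η X ⊗₁ (f ⨾ T₁ (! Y))) ⨾ act X ⨾ T₁ f ⨾ μ Y
      ≡⟨ cong (_⨾ μ Y) (extendʳ (sym act-nat)) ⟩
    ∇ X ⨾ (η X ⊗₁ (f ⨾ T₁ (! Y))) ⨾ (T₁ f ⊗₁ id) ⨾ act (T₀ Y) ⨾ μ Y
      ≡⟨ trans (pullʳ act-μ) (sym assoc) ⟩
    ∇ X ⨾ (η X ⊗₁ (f ⨾ T₁ (! Y))) ⨾ (T₁ f ⊗₁ id) ⨾ (μ Y ⊗₁ id) ⨾ act Y
      ≡⟨ cong (λ h → h ⨾ act Y) (trans (cong (_⨾ (μ Y ⊗₁ id)) (pullʳ ⊗-⨾-first)) (pullʳ ⊗-⨾-first)) ⟩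
    ∇ X ⨾ ((η X ⨾ T₁ f ⨾ μ Y) ⊗₁ (f ⨾ T₁ (! Y))) ⨾ act Y
      ≡⟨ cong (λ h → ∇ X ⨾ (h ⊗₁ (f ⨾ T₁ (! Y))) ⨾ act Y) Kleisli-identityˡ ⟩
    ∇ X ⨾ (f ⊗₁ (f ⨾ T₁ (! Y))) ⨾ act Y
      ≡⟨ cong (_⨾ act Y) (trans (cong (∇ X ⨾_) (sym ⊗-⨾-second)) (sym assoc)) ⟩
    ∇ X ⨾ (f ⊗₁ f) ⨾ (id ⊗₁ T₁ (! Y)) ⨾ act Y
      ≡⟨ cong (λ h → h ⨾ (id ⊗₁ T₁ (! Y)) ⨾ act Y) (sym (copyable f)) ⟩
    f ⨾ ∇ (T₀ Y) ⨾ (id ⊗₁ T₁ (! Y)) ⨾ act Y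
      ≡⟨ trans (cong (_⨾ act Y) assoc) assoc ⟩
    f ⨾ (∇ (T₀ Y) ⨾ (id ⊗₁ T₁ (! Y)) ⨾ act Y)
      ≡⟨ cong (f ⨾_) (sym copyDiscard≡act) ⟩
    f ⨾ copyDiscard Y ∎

  domainPreserving⇔copyDiscard≡id : DomainPreserving G 𝕋 ⇔ (∀ Y → copyDiscard Y ≡ id)
  domainPreserving⇔copyDiscard≡id =
    mk⇔ (λ dp Y → to (pointwise Y) (dp Y)) (λ cd Y → from (pointwise Y) (cd Y))
    where
    open Equivalence using (to; from)
    pointwise : ∀ Y → (∇ (T₀ Y) ⨾ c Y Y ⨾ T₁ (id ⊗₁ ! Y) ≡ T₁ (ρ Y)) ⇔ (copyDiscard Y ≡ id)
    pointwise Y = ≡⇔⨾inverse≡id (T-iso ρ-iso₁) (T-iso ρ-iso₂) _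

  domainCategory⇔copyDiscard≡id : IsRestriction G →
    IsDomainCategory (Kleisli G 𝕋) ⇔ (∀ Y → copyDiscard Y ≡ id)
  domainCategory⇔copyDiscard≡id copyable = mk⇔ to from
    where
    to : IsDomainCategory (Kleisli G 𝕋) → ∀ Y → copyDiscard Y ≡ id
    -- the identity of 𝒞 on T₀ Y, read as a Kleisli arrow T₀ Y → Y
    to domain Y = begin
      copyDiscard Y               ≡⟨ sym identityˡ ⟩
      id ⨾ copyDiscard Y          ≡⟨ sym (Kleisli-dom-⨾ copyable id) ⟩
      K.dom id K.⨾ id             ≡⟨ domain id ⟩
      id                          ∎
    from : (∀ Y → copyDiscard Y ≡ id) → IsDomainCategory (Kleisli G 𝕋)
    from cd {Y = Y} f = begin
      K.dom f K.⨾ f               ≡⟨ Kleisli-dom-⨾ copyable f ⟩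
      f ⨾ copyDiscard Y           ≡⟨ cong (f ⨾_) (cd Y) ⟩
      f ⨾ id                      ≡⟨ identityʳ ⟩
      f                           ∎

theorem5p2 : ∀ {o ℓ} (C : SymmetricMonoidalCategory o ℓ) (G : GSMonoidal C) →
    IsRestriction G → (T : SymmetricMonoidalMonad C) →
    DomainPreserving G T ⇔ IsDomainCategory (Kleisli G T)
theorem5p2 C G R T =
  ⇔-sym (domainCategory⇔copyDiscard≡id R) ⇔-∘ domainPreserving⇔copyDiscard≡id
  where open KleisliDomain G T
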